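{- Let $2\le r<s$ be integers and let $G$ be an $(s,s-r)$-starplus on $k$ vertices with excess $\ell$ satisfying $$\ell\le\frac{r\binom{k-s+r}{r}-(k-s+r)}{k-s}.$$ Then $G$ is balanced, i.e. for every sub-hypergraph $G'\subseteq G$ with $|V(G')|\ge s$, $$\frac{|E(G')|}{|V(G')|-s+r}\le\frac{|E(G)|}{|V(G)|-s+r}.$$
   Context: For integers $1\le c\le s\le k$, a $k$-vertex $s$-uniform hypergraph is a full $c$-star if its edge set consists of all $\binom{k-c}{s-c}$ $s$-subsets of the vertex set containing a fixed vertex set $C$ with $|C|=c$ (the center). An $(s,c)$-starplus of excess $\ell$ is any $s$-uniform hypergraph obtained from a $k$-vertex full $c$-star by adding $\ell$ further edges on the same vertex set (they may intersect, but not contain, $C$). -}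

module Defs where

open import Data.Nat using (ℕ; _+_; _*_; _∸_; _≤_)
open import Data.List using (List; length)
open import Data.List.Membership.Propositional using (_∈_)
open import Data.List.Relation.Unary.All using (All)
open import Data.List.Relation.Unary.Unique.Propositional using (Unique)
open import Data.Fin.Subset using (Subset; _⊆_; ∣_∣)
open import Data.Product using (Σ; _×_)
open import Data.Sum using (_⊎_)
open import Function.Bundles using (_⇔_)
open import Relation.Nullary using (¬_)
open import Relation.Binary.PropositionalEquality using (_≡_)

record Hypergraph (k : ℕ) : Set where
  field
    edges    : List (Subset k)
    distinct : Unique edges
open Hypergraph public

Uniform : ∀ {k} → ℕ → Hypergraph k → Set
Uniform s G = All (λ e → ∣ e ∣ ≡ s) (edges G)

Starplus : ∀ {k} → ℕ → ℕ → ℕ → Hypergraph k → Set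
Starplus {k} s c ℓ G =
  Uniform s G ×
  Σ (Subset k) λ C → ∣ C ∣ ≡ c ×
  Σ (List (Subset k)) λ X →
    Unique X × All (λ e → ∣ e ∣ ≡ s) X × All (λ e → ¬ (C ⊆ e)) X × length X ≡ ℓ ×
    (∀ e → (e ∈ edges G) ⇔ ((∣ e ∣ ≡ s × C ⊆ e) ⊎ e ∈ X))

record SubHypergraph {k : ℕ} (G : Hypergraph k) : Set where
  field
    verts     : Subset k
    subEdges  : List (Subset k)
    subDistinct : Unique subEdges
    subOfG    : All (_∈ edges G) subEdges
    inVerts   : All (_⊆ verts) subEdges
open SubHypergraph public

-- Balanced (w.r.t. parameters s, r): for every sub-hypergraph G' with
-- |V(G')| ≥ s,  |E(G')| / (|V(G')| - s + r) ≤ |E(G)| / (|V(G)| - s + r),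
-- written cross-multiplied (both denominators are positive since r ≥ 1).
Balanced : ∀ {k} → ℕ → ℕ → Hypergraph k → Set
Balanced {k} s r G =
  (H : SubHypergraph G) → s ≤ ∣ verts H ∣ →
  length (subEdges H) * (k ∸ s + r) ≤ length (edges G) * (∣ verts H ∣ ∸ s + r)

-- Let C be the center, c = |C| = s - r, W the vertex set of a sub-hypergraph H, N = k - s + r
-- and m = |W| - s + r.  Every edge of H either contains C, and is then C together with r of
-- the m vertices of W - C, or is one of the ℓ extra edges; so |E(H)| ≤ (m choose r) + ℓ, while
-- |E(G)| ≥ (N choose r) + ℓ.  It remains to see that f(m) = ((m choose r) + ℓ) / m on [r, N]
-- is largest at m = N.  The increments of the numerator are (m choose r-1), increasing in m,
-- so f cannot rise and then fall: its maximum sits at an endpoint, and the bound on ℓ says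
-- exactly f(r) ≤ f(N).
module Submission where

open import Defs
open import Data.Nat using (ℕ; _+_; _*_; _∸_; _≤_; _<_)
open import Data.Nat.Combinatorics using (_C_)

open import Data.Nat using (zero; suc; z≤n; s≤s; _≤′_; ≤′-refl; ≤′-step)
open import Data.Nat.Properties
open import Data.Nat.Combinatorics using (nCn≡1; nCk+nC[k+1]≡[n+1]C[k+1])
open import Data.Nat.Solver using (module +-*-Solver)
open import Data.Fin.Subset using (Subset; inside; outside; _⊆_; _─_; ∣_∣; ⊤)
open import Data.Fin.Subset.Properties
  using (drop-∷-⊆; in⊆in; out⊆; ⊆⊤; ⊆-trans; _⊆?_; p⊆q⇒∣p∣≤∣q∣; ∣⊤∣≡n; ∣p∣≤n)
open import Data.Vec.Base using ([]; _∷_)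
import Data.Vec.Base as Vec
open import Data.Vec.Properties using (∷-injectiveˡ; ∷-injectiveʳ)
open import Data.List using (List; []; _∷_; [_]; length; map; _++_; removeAt)
open import Data.List.Properties using (length-map; length-++; length-removeAt′)
open import Data.List.Membership.Propositional using (_∈_)
open import Data.List.Membership.Propositional.Properties using (∈-map⁺; ∈-map⁻; ∈-++⁺ˡ; ∈-++⁺ʳ)
open import Data.List.Relation.Unary.Any using (here; there; index)
open import Data.List.Relation.Unary.All as All using (All; []; _∷_)
import Data.List.Relation.Unary.All.Properties as All
open import Data.List.Relation.Unary.AllPairs using ([]; _∷_)
open import Data.List.Relation.Unary.Unique.Propositional using (Unique)
import Data.List.Relation.Unary.Unique.Propositional.Properties as Unique
open import Data.List.Relation.Binary.Disjoint.Propositional using (Disjoint)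
open import Data.Product using (_×_; _,_; proj₁)
open import Data.Sum using (inj₁; inj₂)
open import Data.Empty using (⊥-elim)
open import Function using (_∘_)
open import Function.Bundles using (Equivalence)
open import Relation.Nullary using (¬_; yes; no; contradiction)
open import Relation.Binary.PropositionalEquality
  using (_≡_; _≢_; refl; sym; trans; cong; cong₂; subst₂; module ≡-Reasoning)

m∸[n∸o]≡m∸n+o : ∀ {m n o} → o ≤ n → n ≤ m → m ∸ (n ∸ o) ≡ m ∸ n + o
m∸[n∸o]≡m∸n+o {m} {n} {o} o≤n n≤m = begin
  m ∸ (n ∸ o)             ≡⟨ cong (_∸ (n ∸ o)) (sym (m∸n+n≡m n≤m)) ⟩
  (m ∸ n) + n ∸ (n ∸ o)   ≡⟨ +-∸-assoc (m ∸ n) (m∸n≤m n o) ⟩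
  (m ∸ n) + (n ∸ (n ∸ o)) ≡⟨ cong ((m ∸ n) +_) (m∸[m∸n]≡n o≤n) ⟩
  m ∸ n + o               ∎
  where open ≡-Reasoning

nCk≤[1+n]Ck : ∀ n k → n C k ≤ suc n C k
nCk≤[1+n]Ck n zero    = ≤-refl
nCk≤[1+n]Ck n (suc k) = ≤-trans (m≤n+m (n C suc k) (n C k))
                                (≤-reflexive (nCk+nC[k+1]≡[n+1]C[k+1] n k))

C-monoˡ-≤ : ∀ k {m n} → m ≤ n → m C k ≤ n C k
C-monoˡ-≤ k = mono ∘ ≤⇒≤′
  where
  mono : ∀ {m n} → m ≤′ n → m C k ≤ n C k
  mono ≤′-refl        = ≤-refl
  mono (≤′-step m≤′n) = ≤-trans (mono m≤′n) (nCk≤[1+n]Ck _ k)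

-- BelowTop m is f(m) ≤ f(N) for f(m) = (m C r + ℓ) / m, cross-multiplied, with N = d + r.
module Ratio (q d ℓ : ℕ) where

  open +-*-Solver

  r N top : ℕ
  r   = suc q
  N   = d + r
  top = N C r + ℓ

  BelowTop : ℕ → Set
  BelowTop m = (m C r + ℓ) * N ≤ top * m

  numerator-suc : ∀ i → (suc i C r + ℓ) * N ≡ N * (i C q) + (i C r + ℓ) * N
  numerator-suc i = begin
    (suc i C r + ℓ) * N           ≡⟨ cong (λ x → (x + ℓ) * N) (sym (nCk+nC[k+1]≡[n+1]C[k+1] i q)) ⟩
    (i C q + i C r + ℓ) * N       ≡⟨ solve 4 (λ a b l n → (a :+ b :+ l) :* n := n :* a :+ (b :+ l) :* n)
                                          refl (i C q) (i C r) ℓ N ⟩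
    N * (i C q) + (i C r + ℓ) * N ∎
    where open ≡-Reasoning

  step-up : ∀ i → N * (i C q) ≤ top → BelowTop i → BelowTop (suc i)
  step-up i increment≤top below = begin
    (suc i C r + ℓ) * N           ≡⟨ numerator-suc i ⟩
    N * (i C q) + (i C r + ℓ) * N ≤⟨ +-mono-≤ increment≤top below ⟩
    top + top * i                 ≡⟨ sym (*-suc top i) ⟩
    top * suc i                   ∎
    where open ≤-Reasoning

  step-down : ∀ i → top ≤ N * (i C q) → BelowTop (suc i) → BelowTop i
  step-down i top≤increment below = +-cancelˡ-≤ (N * (i C q)) _ _ (begin
    N * (i C q) + (i C r + ℓ) * N ≡⟨ sym (numerator-suc i) ⟩
    (suc i C r + ℓ) * N           ≤⟨ below ⟩
    top * suc i                   ≡⟨ *-suc top i ⟩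
    top + top * i                 ≤⟨ +-monoˡ-≤ (top * i) top≤increment ⟩
    N * (i C q) + top * i         ∎)
    where open ≤-Reasoning

  ascend : ∀ {a b} → a ≤ b → N * (b C q) ≤ top → BelowTop a → BelowTop b
  ascend a≤b = go (≤⇒≤′ a≤b)
    where
    go : ∀ {a b} → a ≤′ b → N * (b C q) ≤ top → BelowTop a → BelowTop b
    go ≤′-refl        _               below = below
    go {b = suc b} (≤′-step a≤′b) increment≤top below = step-up b increment≤top′ (go a≤′b increment≤top′ below)
      where
      increment≤top′ : N * (b C q) ≤ top
      increment≤top′ = ≤-trans (*-monoʳ-≤ N (nCk≤[1+n]Ck b q)) increment≤top

  descend : ∀ {a b} → a ≤ b → top ≤ N * (a C q) → BelowTop b → BelowTop a
  descend a≤b = go (≤⇒≤′ a≤b)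
    where
    go : ∀ {a b} → a ≤′ b → top ≤ N * (a C q) → BelowTop b → BelowTop a
    go ≤′-refl        _               below = below
    go (≤′-step a≤′b) top≤increment below =
      go a≤′b top≤increment
        (step-down _ (≤-trans top≤increment (*-monoʳ-≤ N (C-monoˡ-≤ q (≤′⇒≤ a≤′b)))) below)

  belowTop-r : ℓ * d + N ≤ r * (N C r) → BelowTop r
  belowTop-r bound = begin
    (r C r + ℓ) * N         ≡⟨ cong (λ x → (x + ℓ) * N) (nCn≡1 r) ⟩
    N + ℓ * (d + r)         ≡⟨ solve 3 (λ l d′ r′ → (d′ :+ r′) :+ l :* (d′ :+ r′) := l :* d′ :+ (d′ :+ r′) :+ l :* r′)
                                 refl ℓ d r ⟩
    ℓ * d + N + ℓ * r       ≤⟨ +-monoˡ-≤ (ℓ * r) bound ⟩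
    r * (N C r) + ℓ * r     ≡⟨ solve 3 (λ r′ b l → r′ :* b :+ l :* r′ := (b :+ l) :* r′) refl r (N C r) ℓ ⟩
    top * r                 ∎
    where open ≤-Reasoning

  -- As i ↦ i C q is monotone, either every i ≤ m has N * (i C q) ≤ top (climb from r)
  -- or every i ≥ m has top ≤ N * (i C q) (descend from N).
  belowTop : ∀ {m} → r ≤ m → m ≤ N → ℓ * d + N ≤ r * (N C r) → BelowTop m
  belowTop {m} r≤m m≤N bound with N * (m C q) ≤? top
  ... | yes increment≤top = ascend r≤m increment≤top (belowTop-r bound)
  ... | no  increment≰top = descend m≤N (<⇒≤ (≰⇒> increment≰top)) ≤-refl

∈-removeAt⁺ : ∀ {A : Set} {x y : A} {xs} (x∈xs : x ∈ xs) → y ∈ xs → x ≢ y → y ∈ removeAt xs (index x∈xs)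
∈-removeAt⁺ (here refl) (here refl)  x≢y = contradiction refl x≢y
∈-removeAt⁺ (here refl) (there y∈xs) _   = y∈xs
∈-removeAt⁺ (there _)   (here refl)  _   = here refl
∈-removeAt⁺ (there x∈xs) (there y∈xs) x≢y = there (∈-removeAt⁺ x∈xs y∈xs x≢y)

unique-length≤ : ∀ {A : Set} {xs ys : List A} → Unique xs → All (_∈ ys) xs → length xs ≤ length ys
unique-length≤ [] [] = z≤n
unique-length≤ {xs = _ ∷ xs} {ys} (x≢xs ∷ xs-unique) (x∈ys ∷ xs⊆ys) = begin
  suc (length xs)                          ≤⟨ s≤s (unique-length≤ xs-unique xs⊆ys−x) ⟩
  suc (length (removeAt ys (index x∈ys)))  ≡⟨ sym (length-removeAt′ ys (index x∈ys)) ⟩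
  length ys                                ∎
  where
  open ≤-Reasoning
  xs⊆ys−x : All (_∈ removeAt ys (index x∈ys)) xs
  xs⊆ys−x = All.zipWith (λ (x≢y , y∈ys) → ∈-removeAt⁺ x∈ys y∈ys x≢y) (x≢xs , xs⊆ys)

in⊈out : ∀ {n} {p q : Subset n} → ¬ (inside ∷ p ⊆ outside ∷ q)
in⊈out p⊆q with p⊆q Vec.here
... | ()

∣p─q∣≡∣p∣∸∣q∣ : ∀ {n} {p q : Subset n} → q ⊆ p → ∣ p ─ q ∣ ≡ ∣ p ∣ ∸ ∣ q ∣
∣p─q∣≡∣p∣∸∣q∣ {p = []}          {[]}          _   = refl
∣p─q∣≡∣p∣∸∣q∣ {p = outside ∷ p} {inside  ∷ q} q⊆p = ⊥-elim (in⊈out q⊆p)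
∣p─q∣≡∣p∣∸∣q∣ {p = inside  ∷ p} {inside  ∷ q} q⊆p = ∣p─q∣≡∣p∣∸∣q∣ (drop-∷-⊆ q⊆p)
∣p─q∣≡∣p∣∸∣q∣ {p = inside  ∷ p} {outside ∷ q} q⊆p =
  trans (cong suc (∣p─q∣≡∣p∣∸∣q∣ (drop-∷-⊆ q⊆p))) (sym (+-∸-assoc 1 (p⊆q⇒∣p∣≤∣q∣ (drop-∷-⊆ q⊆p))))
∣p─q∣≡∣p∣∸∣q∣ {p = outside ∷ p} {outside ∷ q} q⊆p = ∣p─q∣≡∣p∣∸∣q∣ (drop-∷-⊆ q⊆p)

extensions : ∀ {n} → Subset n → Subset n → ℕ → List (Subset n)
extensions []            []            zero    = [ [] ]
extensions []            []            (suc t) = []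
extensions (inside  ∷ B) (_       ∷ W) t       = map (inside ∷_) (extensions B W t)
extensions (outside ∷ B) (outside ∷ W) t       = map (outside ∷_) (extensions B W t)
extensions (outside ∷ B) (inside  ∷ W) zero    = map (outside ∷_) (extensions B W zero)
extensions (outside ∷ B) (inside  ∷ W) (suc t) =
  map (inside ∷_) (extensions B W t) ++ map (outside ∷_) (extensions B W (suc t))

Extension : ∀ {n} → Subset n → ℕ → Subset n → Set
Extension B t e = B ⊆ e × ∣ e ∣ ≡ ∣ B ∣ + t

length-extensions : ∀ {n} (B W : Subset n) t → length (extensions B W t) ≡ ∣ W ─ B ∣ C t
length-extensions []            []            zero    = refl
length-extensions []            []            (suc t) = refl
length-extensions (inside  ∷ B) (_       ∷ W) t       =
  trans (length-map _ (extensions B W t)) (length-extensions B W t)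
length-extensions (outside ∷ B) (outside ∷ W) t       =
  trans (length-map _ (extensions B W t)) (length-extensions B W t)
length-extensions (outside ∷ B) (inside  ∷ W) zero    =
  trans (length-map _ (extensions B W zero)) (length-extensions B W zero)
length-extensions (outside ∷ B) (inside  ∷ W) (suc t) = begin
  length (map (inside ∷_) (extensions B W t) ++ map (outside ∷_) (extensions B W (suc t)))
    ≡⟨ length-++ (map (inside ∷_) (extensions B W t)) ⟩
  length (map (inside ∷_) (extensions B W t)) + length (map (outside ∷_) (extensions B W (suc t)))
    ≡⟨ cong₂ _+_ (trans (length-map _ (extensions B W t)) (length-extensions B W t))
                 (trans (length-map _ (extensions B W (suc t))) (length-extensions B W (suc t))) ⟩
  ∣ W ─ B ∣ C t + ∣ W ─ B ∣ C suc t
    ≡⟨ nCk+nC[k+1]≡[n+1]C[k+1] ∣ W ─ B ∣ t ⟩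
  suc ∣ W ─ B ∣ C suc t ∎
  where open ≡-Reasoning

Extension-inside : ∀ {n} {B e : Subset n} {t} → Extension B t e →
                   Extension (inside ∷ B) t (inside ∷ e)
Extension-inside (B⊆e , size) = in⊆in B⊆e , cong suc size

Extension-outside : ∀ {n} {B e : Subset n} {t} → Extension B t e →
                    Extension (outside ∷ B) t (outside ∷ e)
Extension-outside (B⊆e , size) = out⊆ B⊆e , size

Extension-new : ∀ {n} {B e : Subset n} {t} → Extension B t e →
                Extension (outside ∷ B) (suc t) (inside ∷ e)
Extension-new {B = B} {t = t} (B⊆e , size) = out⊆ B⊆e , trans (cong suc size) (sym (+-suc ∣ B ∣ t))

extensions-sound : ∀ {n} (B W : Subset n) t → All (Extension B t) (extensions B W t)
extensions-sound []            []            zero    = ((λ ()) , refl) ∷ []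
extensions-sound []            []            (suc t) = []
extensions-sound (inside  ∷ B) (_       ∷ W) t       =
  All.map⁺ (All.map Extension-inside (extensions-sound B W t))
extensions-sound (outside ∷ B) (outside ∷ W) t       =
  All.map⁺ (All.map Extension-outside (extensions-sound B W t))
extensions-sound (outside ∷ B) (inside  ∷ W) zero    =
  All.map⁺ (All.map Extension-outside (extensions-sound B W zero))
extensions-sound (outside ∷ B) (inside  ∷ W) (suc t) = All.++⁺
  (All.map⁺ (All.map Extension-new (extensions-sound B W t)))
  (All.map⁺ (All.map Extension-outside (extensions-sound B W (suc t))))

∈-extensions⁺ : ∀ {n} {B W e : Subset n} {t} → B ⊆ e → e ⊆ W → ∣ e ∣ ≡ ∣ B ∣ + t →
                e ∈ extensions B W t
∈-extensions⁺ {B = []} {[]} {[]} {zero} _ _ _ = here refl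
∈-extensions⁺ {B = inside ∷ B} {_ ∷ W} {outside ∷ e} B⊆e _ _ = ⊥-elim (in⊈out B⊆e)
∈-extensions⁺ {B = inside ∷ B} {_ ∷ W} {inside ∷ e} B⊆e e⊆W size =
  ∈-map⁺ _ (∈-extensions⁺ (drop-∷-⊆ B⊆e) (drop-∷-⊆ e⊆W) (suc-injective size))
∈-extensions⁺ {B = outside ∷ B} {outside ∷ W} {inside ∷ e} _ e⊆W _ = ⊥-elim (in⊈out e⊆W)
∈-extensions⁺ {B = outside ∷ B} {outside ∷ W} {outside ∷ e} B⊆e e⊆W size =
  ∈-map⁺ _ (∈-extensions⁺ (drop-∷-⊆ B⊆e) (drop-∷-⊆ e⊆W) size)
∈-extensions⁺ {B = outside ∷ B} {inside ∷ W} {inside ∷ e} {zero} B⊆e _ size =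
  contradiction (≤-trans (≤-reflexive (trans size (+-identityʳ ∣ B ∣))) (p⊆q⇒∣p∣≤∣q∣ (drop-∷-⊆ B⊆e)))
                1+n≰n
∈-extensions⁺ {B = outside ∷ B} {inside ∷ W} {outside ∷ e} {zero} B⊆e e⊆W size =
  ∈-map⁺ _ (∈-extensions⁺ (drop-∷-⊆ B⊆e) (drop-∷-⊆ e⊆W) size)
∈-extensions⁺ {B = outside ∷ B} {inside ∷ W} {inside ∷ e} {suc t} B⊆e e⊆W size =
  ∈-++⁺ˡ (∈-map⁺ _ (∈-extensions⁺ (drop-∷-⊆ B⊆e) (drop-∷-⊆ e⊆W)
                                   (suc-injective (trans size (+-suc ∣ B ∣ t)))))
∈-extensions⁺ {B = outside ∷ B} {inside ∷ W} {outside ∷ e} {suc t} B⊆e e⊆W size =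
  ∈-++⁺ʳ _ (∈-map⁺ _ (∈-extensions⁺ (drop-∷-⊆ B⊆e) (drop-∷-⊆ e⊆W) size))

inside-outside-disjoint : ∀ {n} (xs ys : List (Subset n)) →
                          Disjoint (map (inside ∷_) xs) (map (outside ∷_) ys)
inside-outside-disjoint xs ys (v∈xs , v∈ys)
  with _ , _ , refl ← ∈-map⁻ (inside ∷_) v∈xs
  with _ , _ , eq   ← ∈-map⁻ (outside ∷_) v∈ys
  with () ← ∷-injectiveˡ eq

extensions-unique : ∀ {n} (B W : Subset n) t → Unique (extensions B W t)
extensions-unique []            []            zero    = [] ∷ []
extensions-unique []            []            (suc t) = []
extensions-unique (inside  ∷ B) (_       ∷ W) t       =
  Unique.map⁺ ∷-injectiveʳ (extensions-unique B W t)
extensions-unique (outside ∷ B) (outside ∷ W) t       =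
  Unique.map⁺ ∷-injectiveʳ (extensions-unique B W t)
extensions-unique (outside ∷ B) (inside  ∷ W) zero    =
  Unique.map⁺ ∷-injectiveʳ (extensions-unique B W zero)
extensions-unique (outside ∷ B) (inside  ∷ W) (suc t) = Unique.++⁺
  (Unique.map⁺ ∷-injectiveʳ (extensions-unique B W t))
  (Unique.map⁺ ∷-injectiveʳ (extensions-unique B W (suc t)))
  (inside-outside-disjoint (extensions B W t) (extensions B W (suc t)))

starplus-edges≥ : ∀ {k s c ℓ} {G : Hypergraph k} → c ≤ s → Starplus s c ℓ G →
                  (k ∸ c) C (s ∸ c) + ℓ ≤ length (edges G)
starplus-edges≥ {k} {s} {c} {ℓ} {G} c≤s (_ , C₀ , ∣C₀∣≡c , X , X-unique , _ , X∌C₀ , ∣X∣≡ℓ , edge⇔) = begin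
  (k ∸ c) C t + ℓ                       ≡⟨ cong₂ (λ a b → a C t + b) (sym free≡k∸c) (sym ∣X∣≡ℓ) ⟩
  ∣ ⊤ ─ C₀ ∣ C t + length X             ≡⟨ cong (_+ length X) (sym (length-extensions C₀ ⊤ t)) ⟩
  length (extensions C₀ ⊤ t) + length X ≡⟨ sym (length-++ (extensions C₀ ⊤ t)) ⟩
  length (extensions C₀ ⊤ t ++ X)       ≤⟨ unique-length≤ star+X-unique star+X⊆edges ⟩
  length (edges G)                      ∎
  where
  open ≤-Reasoning
  t = s ∸ c
  free≡k∸c : ∣ ⊤ ─ C₀ ∣ ≡ k ∸ c
  free≡k∸c = trans (∣p─q∣≡∣p∣∸∣q∣ {p = ⊤} {C₀} ⊆⊤) (cong₂ _∸_ (∣⊤∣≡n k) ∣C₀∣≡c)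
  star-sound : All (Extension C₀ t) (extensions C₀ ⊤ t)
  star-sound = extensions-sound C₀ ⊤ t
  star+X-unique : Unique (extensions C₀ ⊤ t ++ X)
  star+X-unique = Unique.++⁺ (extensions-unique C₀ ⊤ t) X-unique
    (λ (e∈star , e∈X) → All.lookup X∌C₀ e∈X (proj₁ (All.lookup star-sound e∈star)))
  star-edge : ∀ {e} → Extension C₀ t e → e ∈ edges G
  star-edge (C₀⊆e , size) =
    Equivalence.from (edge⇔ _) (inj₁ (trans size (trans (cong (_+ t) ∣C₀∣≡c) (m+[n∸m]≡n c≤s)) , C₀⊆e))
  star+X⊆edges : All (_∈ edges G) (extensions C₀ ⊤ t ++ X)
  star+X⊆edges = All.++⁺ (All.map star-edge star-sound) (All.tabulate (Equivalence.from (edge⇔ _) ∘ inj₂))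

starplus-subEdges≤ : ∀ {k s c ℓ} {G : Hypergraph k} → c ≤ s → Starplus s c ℓ G →
                     (H : SubHypergraph G) → length (subEdges H) ≤ (∣ verts H ∣ ∸ c) C (s ∸ c) + ℓ
starplus-subEdges≤ {s = s} {c} {ℓ} {G} c≤s (_ , C₀ , ∣C₀∣≡c , X , _ , _ , _ , ∣X∣≡ℓ , edge⇔) H
  with C₀ ⊆? verts H
... | yes C₀⊆W = begin
  length (subEdges H)                   ≤⟨ unique-length≤ (subDistinct H) (All.map classify subEdges-in-W) ⟩
  length (extensions C₀ W t ++ X)       ≡⟨ length-++ (extensions C₀ W t) ⟩
  length (extensions C₀ W t) + length X ≡⟨ cong₂ _+_ (length-extensions C₀ W t) ∣X∣≡ℓ ⟩
  ∣ W ─ C₀ ∣ C t + ℓ                    ≡⟨ cong (λ a → a C t + ℓ) free≡∣W∣∸c ⟩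
  (∣ W ∣ ∸ c) C t + ℓ                   ∎
  where
  open ≤-Reasoning
  W = verts H
  t = s ∸ c
  free≡∣W∣∸c : ∣ W ─ C₀ ∣ ≡ ∣ W ∣ ∸ c
  free≡∣W∣∸c = trans (∣p─q∣≡∣p∣∸∣q∣ C₀⊆W) (cong (∣ W ∣ ∸_) ∣C₀∣≡c)
  subEdges-in-W : All (λ e → e ∈ edges G × e ⊆ W) (subEdges H)
  subEdges-in-W = All.zip (subOfG H , inVerts H)
  classify : ∀ {e} → e ∈ edges G × e ⊆ W → e ∈ extensions C₀ W t ++ X
  classify (e∈G , e⊆W) with Equivalence.to (edge⇔ _) e∈G
  ... | inj₁ (∣e∣≡s , C₀⊆e) = ∈-++⁺ˡ (∈-extensions⁺ C₀⊆e e⊆W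
          (trans ∣e∣≡s (sym (trans (cong (_+ t) ∣C₀∣≡c) (m+[n∸m]≡n c≤s)))))
  ... | inj₂ e∈X = ∈-++⁺ʳ _ e∈X
... | no C₀⊈W = begin
  length (subEdges H)             ≤⟨ unique-length≤ (subDistinct H) (All.map extra subEdges-in-W) ⟩
  length X                        ≡⟨ ∣X∣≡ℓ ⟩
  ℓ                               ≤⟨ m≤n+m ℓ _ ⟩
  (∣ verts H ∣ ∸ c) C (s ∸ c) + ℓ ∎
  where
  open ≤-Reasoning
  subEdges-in-W : All (λ e → e ∈ edges G × e ⊆ verts H) (subEdges H)
  subEdges-in-W = All.zip (subOfG H , inVerts H)
  extra : ∀ {e} → e ∈ edges G × e ⊆ verts H → e ∈ X
  extra (e∈G , e⊆W) with Equivalence.to (edge⇔ _) e∈G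
  ... | inj₁ (_ , C₀⊆e) = ⊥-elim (C₀⊈W (⊆-trans C₀⊆e e⊆W))
  ... | inj₂ e∈X = e∈X

mainTheorem16 : ∀ {k : ℕ} (r s ℓ : ℕ) → 2 ≤ r → r < s → s ≤ k →
    (G : Hypergraph k) → Starplus s (s ∸ r) ℓ G →
    ℓ * (k ∸ s) + (k ∸ s + r) ≤ r * ((k ∸ s + r) C r) →
    Balanced s r G
mainTheorem16 {k} r@(suc q) s ℓ (s≤s _) r<s s≤k G starplus bound H s≤∣W∣ = begin
  length (subEdges H) * N ≤⟨ *-monoˡ-≤ N subEdges≤ ⟩
  (m C r + ℓ) * N         ≤⟨ Ratio.belowTop q (k ∸ s) ℓ (m≤n+m r _) m≤N bound ⟩
  (N C r + ℓ) * m         ≤⟨ *-monoˡ-≤ m edges≥ ⟩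
  length (edges G) * m    ∎
  where
  open ≤-Reasoning
  N m : ℕ
  N = k ∸ s + r
  m = ∣ verts H ∣ ∸ s + r
  r≤s : r ≤ s
  r≤s = <⇒≤ r<s
  m≤N : m ≤ N
  m≤N = +-monoˡ-≤ r (∸-monoˡ-≤ s (∣p∣≤n (verts H)))
  subEdges≤ : length (subEdges H) ≤ m C r + ℓ
  subEdges≤ = subst₂ (λ a b → length (subEdges H) ≤ a C b + ℓ)
                     (m∸[n∸o]≡m∸n+o r≤s s≤∣W∣) (m∸[m∸n]≡n r≤s)
                     (starplus-subEdges≤ (m∸n≤m s r) starplus H)
  edges≥ : N C r + ℓ ≤ length (edges G)
  edges≥ = subst₂ (λ a b → a C b + ℓ ≤ length (edges G))
                  (m∸[n∸o]≡m∸n+o r≤s s≤k) (m∸[m∸n]≡n r≤s)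
                  (starplus-edges≥ {G = G} (m∸n≤m s r) starplus)
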